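{- Let $\Lambda$ be a restorative similarity type and $\mathfrak{M}=\langle W,R,\{P_k\}_{k\in K}\rangle$ an image-finite Kripke model. Then for all $w,v\in W$: $w\rightsquigarrow_\Lambda v$ if and only if $w\mathrel{\underline{\to}}_\Lambda v$.
   Context: A Kripke model is image-finite if $R[w]=\{v\in W: wRv\}$ is finite for every $w\in W$. $w\rightsquigarrow_\Lambda v$ means: for every $\varphi\in\mathcal{L}_\Lambda$, $\mathfrak{M},w\Vdash\varphi$ implies $\mathfrak{M},v\Vdash\varphi$. $w\mathrel{\underline{\to}}_\Lambda v$ means: there is a $\Lambda$-simulation $S$ on $\mathfrak{M}$ with $(w,v)\in S$. Fix a set $K$ of indices for propositional letters $p_k$. Consider six unary connectives $\smile,\frown,\circ_\smile,\circ_\frown,\bullet_\smile,\bullet_\frown$. A restorative similarity type is any subset $\Lambda\subseteq\{\smile,\frown,\circ_\smile,\circ_\frown,\bullet_\smile,\bullet_\frown\}$. The language $\mathcal{L}_\Lambda$ is generated by $\phi::=p_k\mid\top\mid\bot\mid\phi\wedge\phi\mid\phi\vee\phi\mid\star\phi$ with $k\in K$, $\star\in\Lambda$. A Kripke model is $\mathfrak{M}=\langle W,R,\{P_k\}_{k\in K}\rangle$ with $W$ nonempty, $R\subseteq W\times W$, each $P_k\subseteq W$. Satisfaction: $w\Vdash p_k$ iff $w\in P_k$; $\top$ true everywhere, $\bot$ nowhere; $\wedge,\vee$ classical; $w\Vdash\smile\phi$ iff some $v$ with $wRv$ has $v\not\Vdash\phi$; $w\Vdash\frown\phi$ iff every $v$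 with $wRv$ has $v\not\Vdash\phi$; $w\Vdash\circ_\smile\phi$ iff $w\not\Vdash\phi$ or every $v$ with $wRv$ has $v\Vdash\phi$; $w\Vdash\circ_\frown\phi$ iff $w\Vdash\phi$ or every $v$ with $wRv$ has $v\not\Vdash\phi$; $w\Vdash\bullet_\smile\phi$ iff $w\Vdash\phi$ and some $v$ with $wRv$ has $v\not\Vdash\phi$; $w\Vdash\bullet_\frown\phi$ iff $w\not\Vdash\phi$ and some $v$ with $wRv$ has $v\Vdash\phi$. A relation $S\subseteq W\times W$ is a $\Lambda$-simulation on $\mathfrak{M}$ if it satisfies (Sim$_k$) for every $k\in K$ and (Sim$\star$) for every $\star\in\Lambda$ (worlds range over $W$): (Sim$_k$) if $(w,v)\in S$ and $w\in P_k$ then $v\in P_k$; (Sim$\smile$) if $(w,v)\in S$ and $wRs$ then there is $t$ with $vRt$ and $(t,s)\in S$; (Sim$\frown$) if $(w,v)\in S$ and $vRt$ then there is $s$ with $wRs$ and $(t,s)\in S$; (Sim$\circ_\smile$) if $(w,v)\in S$ and $vRt$ then either $(v,t)\in S$, or both $(v,w)\in S$ and there is $s$ with $wRs$ and $(s,t)\in S$; (Sim$\circ_\frown$) if $(w,v)\in S$ and $vRt$ then either $(t,v)\in S$, or there is $s$ with $wRs$ and $(t,s)\in S$; (Sim$\bullet_\smile$) if $(w,v)\in S$ and $wRs$ then either $(w,s)\in S$, or there is $t$ with $vRt$ and $(t,s)\in S$; (Sim$\bullet_\frown$) if $(w,v)\in S$ and $wRs$ then either $(s,w)\in S$, or both $(v,w)\in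 S$ and there is $t$ with $vRt$ and $(s,t)\in S$. -}

module Defs where

open import Data.Product using (Σ; ∃; _×_; _,_)
open import Data.Sum using (_⊎_)
open import Data.List using (List)
open import Data.List.Membership.Propositional using (_∈_)
open import Relation.Nullary using (¬_)
open import Data.Unit using (⊤)
open import Data.Empty using (⊥)

data Conn : Set where
  smile frown circSmile circFrown bulletSmile bulletFrown : Conn

SimType : Set₁
SimType = Conn → Set

record Model (K : Set) : Set₁ where
  field
    W : Set
    R : W → W → Set
    P : K → W → Set
    inhabited : W

data Form (K : Set) (Λ : SimType) : Set where
  var  : K → Form K Λ
  ⊤f   : Form K Λ
  ⊥f   : Form K Λ
  _∧f_ : Form K Λ → Form K Λ → Form K Λ
  _∨f_ : Form K Λ → Form K Λ → Form K Λ
  op   : (c : Conn) → Λ c → Form K Λ → Form K Λ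

module _ {K : Set} {Λ : SimType} (M : Model K) where
  open Model M

  _⊩_ : W → Form K Λ → Set
  sem : Conn → W → Form K Λ → Set

  w ⊩ var k = P k w
  w ⊩ ⊤f = ⊤
  w ⊩ ⊥f = ⊥
  w ⊩ (φ ∧f ψ) = (w ⊩ φ) × (w ⊩ ψ)
  w ⊩ (φ ∨f ψ) = (w ⊩ φ) ⊎ (w ⊩ ψ)
  w ⊩ op c _ φ = sem c w φ

  sem smile w φ = ∃ λ v → R w v × ¬ (v ⊩ φ)
  sem frown w φ = ∀ v → R w v → ¬ (v ⊩ φ)
  sem circSmile w φ = ¬ (w ⊩ φ) ⊎ (∀ v → R w v → v ⊩ φ)
  sem circFrown w φ = (w ⊩ φ) ⊎ (∀ v → R w v → ¬ (v ⊩ φ))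
  sem bulletSmile w φ = (w ⊩ φ) × (∃ λ v → R w v × ¬ (v ⊩ φ))
  sem bulletFrown w φ = ¬ (w ⊩ φ) × (∃ λ v → R w v × (v ⊩ φ))

  -- image-finiteness: each R[w] is contained in (hence is) a finite set
  ImageFinite : Set
  ImageFinite = ∀ w → ∃ λ (xs : List W) → ∀ v → R w v → v ∈ xs

  _⇝_ : W → W → Set
  w ⇝ v = ∀ (φ : Form K Λ) → w ⊩ φ → v ⊩ φ

  record IsSimulation (S : W → W → Set) : Set where
    field
      simK : ∀ k {w v} → S w v → P k w → P k v
      simSmile : Λ smile → ∀ {w v s} → S w v → R w s →
                 ∃ λ t → R v t × S t s
      simFrown : Λ frown → ∀ {w v t} → S w v → R v t →
                 ∃ λ s → R w s × S t s
      simCircSmile : Λ circSmile → ∀ {w v t} → S w v → R v t →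
                 S v t ⊎ (S v w × (∃ λ s → R w s × S s t))
      simCircFrown : Λ circFrown → ∀ {w v t} → S w v → R v t →
                 S t v ⊎ (∃ λ s → R w s × S t s)
      simBulletSmile : Λ bulletSmile → ∀ {w v s} → S w v → R w s →
                 S w s ⊎ (∃ λ t → R v t × S t s)
      simBulletFrown : Λ bulletFrown → ∀ {w v s} → S w v → R w s →
                 S s w ⊎ (S v w × (∃ λ t → R v t × S s t))

  _↠_ : W → W → Set₁
  w ↠ v = ∃ λ (S : W → W → Set) → IsSimulation S × S w v

-- Conversely, on an
-- image-finite model the preservation relation ⇝ is itself a simulation: if a
-- clause failed at w ⇝ v, excluded middle gives for each of the finitely many
-- relevant successors a formula separating it from the target world, and their
-- disjunction or conjunction ψ (combined, for clauses with an alternative, with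
-- a formula refuting that alternative) yields a formula ⋆ ψ true at w but false
-- at v.
module Submission where

open import Defs
open import Axiom.DoubleNegationElimination using (em⇒dne)
open import Axiom.ExcludedMiddle using (ExcludedMiddle)
open import Data.Empty using (⊥-elim)
open import Data.List using (List; []; _∷_)
open import Data.List.Membership.Propositional using (_∈_)
open import Data.List.Relation.Unary.Any using (here; there)
open import Data.Product using (_×_; ∃; _,_; proj₁; proj₂)
open import Data.Sum using (_⊎_; inj₁; inj₂; [_,_])
open import Data.Unit using (tt)
open import Level using (0ℓ)
open import Relation.Binary.PropositionalEquality using (refl)
open import Relation.Nullary using (¬_; yes; no)

module Classical (em : ExcludedMiddle 0ℓ) where

  dne : {A : Set} → ¬ ¬ A → A
  dne = em⇒dne em

  ¬⇒⊎ : {A B : Set} → (¬ A → B) → A ⊎ B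
  ¬⇒⊎ {A} f with em {A}
  ... | yes a = inj₁ a
  ... | no ¬a = inj₂ (f ¬a)

  module _ {K : Set} {Λ : SimType} (M : Model K) where
    open Model M

    _⊨_ : W → Form K Λ → Set
    w ⊨ φ = _⊩_ M w φ

    _≼_ : W → W → Set
    a ≼ b = _⇝_ {K} {Λ} M a b

    circSmile-successors : ∀ {w} c φ → w ⊨ op circSmile c φ → w ⊨ φ → ∀ s → R w s → s ⊨ φ
    circSmile-successors _ _ (inj₁ w⊭φ) w⊨φ = ⊥-elim (w⊭φ w⊨φ)
    circSmile-successors _ _ (inj₂ successors⊨φ) _ = successors⊨φ

    circFrown-predecessor : ∀ {v t} c φ → v ⊨ op circFrown c φ → R v t → t ⊨ φ → v ⊨ φ
    circFrown-predecessor _ _ (inj₁ v⊨φ) _ _ = v⊨φ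
    circFrown-predecessor _ _ (inj₂ successors⊭φ) Rvt t⊨φ = ⊥-elim (successors⊭φ _ Rvt t⊨φ)

    module _ {S : W → W → Set} (sim : IsSimulation {K} {Λ} M S) where
      open IsSimulation sim

      simulation-preserves : ∀ φ {w v} → S w v → w ⊨ φ → v ⊨ φ
      simulation-preserves (var k) Swv w⊨ = simK k Swv w⊨
      simulation-preserves ⊤f Swv w⊨ = w⊨
      simulation-preserves ⊥f Swv ()
      simulation-preserves (φ ∧f ψ) Swv (w⊨φ , w⊨ψ) =
        simulation-preserves φ Swv w⊨φ , simulation-preserves ψ Swv w⊨ψ
      simulation-preserves (φ ∨f ψ) Swv (inj₁ w⊨φ) = inj₁ (simulation-preserves φ Swv w⊨φ)
      simulation-preserves (φ ∨f ψ) Swv (inj₂ w⊨ψ) = inj₂ (simulation-preserves ψ Swv w⊨ψ)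
      simulation-preserves (op smile c φ) Swv (s , Rws , s⊭φ) =
        let (t , Rvt , Sts) = simSmile c Swv Rws
        in t , Rvt , λ t⊨φ → s⊭φ (simulation-preserves φ Sts t⊨φ)
      simulation-preserves (op frown c φ) Swv w⊨ t Rvt t⊨φ =
        let (s , Rws , Sts) = simFrown c Swv Rvt
        in w⊨ s Rws (simulation-preserves φ Sts t⊨φ)
      simulation-preserves (op circSmile c φ) {v = v} Swv w⊨ with em {v ⊨ φ}
      ... | no v⊭φ = inj₁ v⊭φ
      ... | yes v⊨φ = inj₂ successors⊨φ
        where
        successors⊨φ : ∀ t → R v t → t ⊨ φ
        successors⊨φ t Rvt with simCircSmile c Swv Rvt
        ... | inj₁ Svt = simulation-preserves φ Svt v⊨φ
        ... | inj₂ (Svw , s , Rws , Sst) =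
          let w⊨φ = simulation-preserves φ Svw v⊨φ
          in simulation-preserves φ Sst (circSmile-successors c φ w⊨ w⊨φ s Rws)
      simulation-preserves (op circFrown c φ) Swv (inj₁ w⊨φ) =
        inj₁ (simulation-preserves φ Swv w⊨φ)
      simulation-preserves (op circFrown c φ) {v = v} Swv (inj₂ w-successors⊭φ) =
        ¬⇒⊎ v-successors⊭φ
        where
        v-successors⊭φ : ¬ v ⊨ φ → ∀ t → R v t → ¬ t ⊨ φ
        v-successors⊭φ v⊭φ t Rvt t⊨φ with simCircFrown c Swv Rvt
        ... | inj₁ Stv = v⊭φ (simulation-preserves φ Stv t⊨φ)
        ... | inj₂ (s , Rws , Sts) = w-successors⊭φ s Rws (simulation-preserves φ Sts t⊨φ)
      simulation-preserves (op bulletSmile c φ) Swv (w⊨φ , s , Rws , s⊭φ)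
        with simBulletSmile c Swv Rws
      ... | inj₁ Sws = ⊥-elim (s⊭φ (simulation-preserves φ Sws w⊨φ))
      ... | inj₂ (t , Rvt , Sts) =
        simulation-preserves φ Swv w⊨φ , t , Rvt , λ t⊨φ → s⊭φ (simulation-preserves φ Sts t⊨φ)
      simulation-preserves (op bulletFrown c φ) Swv (w⊭φ , s , Rws , s⊨φ)
        with simBulletFrown c Swv Rws
      ... | inj₁ Ssw = ⊥-elim (w⊭φ (simulation-preserves φ Ssw s⊨φ))
      ... | inj₂ (Svw , t , Rvt , Sst) =
        (λ v⊨φ → w⊭φ (simulation-preserves φ Svw v⊨φ)) , t , Rvt , simulation-preserves φ Sst s⊨φ

    separator : ∀ {a b} → ¬ a ≼ b → ∃ λ φ → a ⊨ φ × ¬ b ⊨ φ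
    separator a⋠b = dne λ none →
      a⋠b λ φ a⊨φ → dne λ b⊭φ → none (φ , a⊨φ , b⊭φ)

    ∨-separator : ∀ (xs : List W) s →
      ∃ λ ψ → ¬ s ⊨ ψ × (∀ {t} → t ∈ xs → ¬ t ≼ s → t ⊨ ψ)
    ∨-separator [] s = ⊥f , (λ ()) , λ ()
    ∨-separator (x ∷ xs) s with em {x ≼ s} | ∨-separator xs s
    ... | yes x≼s | ψ , s⊭ψ , xs⊨ψ = ψ , s⊭ψ , λ
      { (here refl) t⋠s → ⊥-elim (t⋠s x≼s)
      ; (there t∈xs) t⋠s → xs⊨ψ t∈xs t⋠s }
    ... | no x⋠s | ψ , s⊭ψ , xs⊨ψ =
      let (φ , x⊨φ , s⊭φ) = separator x⋠s
      in φ ∨f ψ , (λ { (inj₁ s⊨φ) → s⊭φ s⊨φ ; (inj₂ s⊨ψ) → s⊭ψ s⊨ψ }) , λ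
        { (here refl) _ → inj₁ x⊨φ
        ; (there t∈xs) t⋠s → inj₂ (xs⊨ψ t∈xs t⋠s) }

    ∧-separator : ∀ t (xs : List W) →
      ∃ λ ψ → t ⊨ ψ × (∀ {s} → s ∈ xs → ¬ t ≼ s → ¬ s ⊨ ψ)
    ∧-separator t [] = ⊤f , tt , λ ()
    ∧-separator t (x ∷ xs) with em {t ≼ x} | ∧-separator t xs
    ... | yes t≼x | ψ , t⊨ψ , xs⊭ψ = ψ , t⊨ψ , λ
      { (here refl) t⋠s → ⊥-elim (t⋠s t≼x)
      ; (there s∈xs) t⋠s → xs⊭ψ s∈xs t⋠s }
    ... | no t⋠x | ψ , t⊨ψ , xs⊭ψ =
      let (φ , t⊨φ , x⊭φ) = separator t⋠x
      in φ ∧f ψ , (t⊨φ , t⊨ψ) , λ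
        { (here refl) _ (x⊨φ , _) → x⊭φ x⊨φ
        ; (there s∈xs) t⋠s (_ , s⊨ψ) → xs⊭ψ s∈xs t⋠s s⊨ψ }

    module _ (image-finite : ImageFinite {K} {Λ} M) where

      successor-∨-separator : ∀ v s →
        ∃ λ ψ → ¬ s ⊨ ψ × (∀ {t} → R v t → ¬ t ≼ s → t ⊨ ψ)
      successor-∨-separator v s =
        let (xs , R[v]⊆xs) = image-finite v
            (ψ , s⊭ψ , xs⊨ψ) = ∨-separator xs s
        in ψ , s⊭ψ , λ Rvt → xs⊨ψ (R[v]⊆xs _ Rvt)

      successor-∧-separator : ∀ t w →
        ∃ λ ψ → t ⊨ ψ × (∀ {s} → R w s → ¬ t ≼ s → ¬ s ⊨ ψ)
      successor-∧-separator t w =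
        let (xs , R[w]⊆xs) = image-finite w
            (ψ , t⊨ψ , xs⊭ψ) = ∧-separator t xs
        in ψ , t⊨ψ , λ Rws → xs⊭ψ (R[w]⊆xs _ Rws)

      ≼-simSmile : Λ smile → ∀ {w v s} → w ≼ v → R w s → ∃ λ t → R v t × t ≼ s
      ≼-simSmile c {v = v} {s} w≼v Rws = dne λ none →
        let (ψ , s⊭ψ , v-successors⊨ψ) = successor-∨-separator v s
            (t , Rvt , t⊭ψ) = w≼v (op smile c ψ) (s , Rws , s⊭ψ)
        in t⊭ψ (v-successors⊨ψ Rvt λ t≼s → none (t , Rvt , t≼s))

      ≼-simFrown : Λ frown → ∀ {w v t} → w ≼ v → R v t → ∃ λ s → R w s × t ≼ s
      ≼-simFrown c {w} {t = t} w≼v Rvt = dne λ none →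
        let (ψ , t⊨ψ , w-successors⊭ψ) = successor-∧-separator t w
            w⊨⌢ψ : w ⊨ op frown c ψ
            w⊨⌢ψ s Rws = w-successors⊭ψ Rws λ t≼s → none (s , Rws , t≼s)
        in w≼v (op frown c ψ) w⊨⌢ψ t Rvt t⊨ψ

      ≼-simCircSmile : Λ circSmile → ∀ {w v t} → w ≼ v → R v t →
        v ≼ t ⊎ (v ≼ w × ∃ λ s → R w s × s ≼ t)
      ≼-simCircSmile c {w} {v} {t} w≼v Rvt = ¬⇒⊎ λ v⋠t →
        v≼w (separator v⋠t) , successor≼t (separator v⋠t)
        where
        v≼w : ∃ (λ α → v ⊨ α × ¬ t ⊨ α) → v ≼ w
        v≼w (α , v⊨α , t⊭α) = dne λ v⋠w →
          let (β , v⊨β , w⊭β) = separator v⋠w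
              w⊨∘⌣α∧β = inj₁ λ w⊨α∧β → w⊭β (proj₂ w⊨α∧β)
          in t⊭α (proj₁ (circSmile-successors c (α ∧f β)
                           (w≼v (op circSmile c (α ∧f β)) w⊨∘⌣α∧β) (v⊨α , v⊨β) t Rvt))

        successor≼t : ∃ (λ α → v ⊨ α × ¬ t ⊨ α) → ∃ λ s → R w s × s ≼ t
        successor≼t (α , v⊨α , t⊭α) = dne λ none →
          let (ψ , t⊭ψ , w-successors⊨ψ) = successor-∨-separator w t
              w⊨∘⌣α∨ψ = inj₂ λ s Rws → inj₂ (w-successors⊨ψ Rws λ s≼t → none (s , Rws , s≼t))
          in [ t⊭α , t⊭ψ ] (circSmile-successors c (α ∨f ψ)
                              (w≼v (op circSmile c (α ∨f ψ)) w⊨∘⌣α∨ψ) (inj₁ v⊨α) t Rvt)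

      ≼-simCircFrown : Λ circFrown → ∀ {w v t} → w ≼ v → R v t →
        t ≼ v ⊎ ∃ λ s → R w s × t ≼ s
      ≼-simCircFrown c {w} {t = t} w≼v Rvt = ¬⇒⊎ λ t⋠v → dne λ none →
        let (α , t⊨α , v⊭α) = separator t⋠v
            (ψ , t⊨ψ , w-successors⊭ψ) = successor-∧-separator t w
            w⊨∘⌢α∧ψ : w ⊨ op circFrown c (α ∧f ψ)
            w⊨∘⌢α∧ψ = inj₂ λ s Rws s⊨α∧ψ →
              w-successors⊭ψ Rws (λ t≼s → none (s , Rws , t≼s)) (proj₂ s⊨α∧ψ)
        in v⊭α (proj₁ (circFrown-predecessor c (α ∧f ψ)
                         (w≼v (op circFrown c (α ∧f ψ)) w⊨∘⌢α∧ψ) Rvt (t⊨α , t⊨ψ)))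

      ≼-simBulletSmile : Λ bulletSmile → ∀ {w v s} → w ≼ v → R w s →
        w ≼ s ⊎ ∃ λ t → R v t × t ≼ s
      ≼-simBulletSmile c {v = v} {s} w≼v Rws = ¬⇒⊎ λ w⋠s → dne λ none →
        let (α , w⊨α , s⊭α) = separator w⋠s
            (ψ , s⊭ψ , v-successors⊨ψ) = successor-∨-separator v s
            (_ , t , Rvt , t⊭α∨ψ) =
              w≼v (op bulletSmile c (α ∨f ψ)) (inj₁ w⊨α , s , Rws , [ s⊭α , s⊭ψ ])
        in t⊭α∨ψ (inj₂ (v-successors⊨ψ Rvt λ t≼s → none (t , Rvt , t≼s)))

      ≼-simBulletFrown : Λ bulletFrown → ∀ {w v s} → w ≼ v → R w s →
        s ≼ w ⊎ (v ≼ w × ∃ λ t → R v t × s ≼ t)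
      ≼-simBulletFrown c {w} {v} {s} w≼v Rws = ¬⇒⊎ λ s⋠w →
        v≼w (separator s⋠w) , s≼successor (separator s⋠w)
        where
        v≼w : ∃ (λ α → s ⊨ α × ¬ w ⊨ α) → v ≼ w
        v≼w (α , s⊨α , w⊭α) = dne λ v⋠w →
          let (β , v⊨β , w⊭β) = separator v⋠w
              (v⊭α∨β , _) =
                w≼v (op bulletFrown c (α ∨f β)) ([ w⊭α , w⊭β ] , s , Rws , inj₁ s⊨α)
          in v⊭α∨β (inj₂ v⊨β)

        s≼successor : ∃ (λ α → s ⊨ α × ¬ w ⊨ α) → ∃ λ t → R v t × s ≼ t
        s≼successor (α , s⊨α , w⊭α) = dne λ none →
          let (ψ , s⊨ψ , v-successors⊭ψ) = successor-∧-separator s v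
              w⊨∙⌢α∧ψ = (λ w⊨α∧ψ → w⊭α (proj₁ w⊨α∧ψ)) , s , Rws , (s⊨α , s⊨ψ)
              (_ , t , Rvt , (_ , t⊨ψ)) = w≼v (op bulletFrown c (α ∧f ψ)) w⊨∙⌢α∧ψ
          in v-successors⊭ψ Rvt (λ s≼t → none (t , Rvt , s≼t)) t⊨ψ

      ≼-isSimulation : IsSimulation {K} {Λ} M _≼_
      ≼-isSimulation = record
        { simK = λ k w≼v → w≼v (var k)
        ; simSmile = ≼-simSmile
        ; simFrown = ≼-simFrown
        ; simCircSmile = ≼-simCircSmile
        ; simCircFrown = ≼-simCircFrown
        ; simBulletSmile = ≼-simBulletSmile
        ; simBulletFrown = ≼-simBulletFrown
        }

theorem6p4 : ExcludedMiddle 0ℓ →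
    (K : Set) (Λ : SimType) (M : Model K) →
    ImageFinite {K} {Λ} M →
    ∀ w v → (_⇝_ {K} {Λ} M w v → _↠_ {K} {Λ} M w v)
          × (_↠_ {K} {Λ} M w v → _⇝_ {K} {Λ} M w v)
theorem6p4 em K Λ M image-finite w v =
  (λ w⇝v → _ , ≼-isSimulation M image-finite , w⇝v) ,
  (λ (S , S-isSimulation , Swv) φ → simulation-preserves M S-isSimulation φ Swv)
  where open Classical em
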